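{- Let $k \ge 2$ be a fixed integer and let $T$ be a tree of order $n$. (a) If $T = T_k$, then $\gamma^{\mathrm{IOC}}(T) = \left( \frac{2k}{2k+1} \right) n$, and the set consisting of all vertices of $T$ except exactly one leaf is an IO-code of $T$ of minimum cardinality. (b) If $k \ge 3$ and $T = T_k^*$, then $\gamma^{\mathrm{IOC}}(T) = \left( \frac{2k-1}{2k} \right) n$, and the set consisting of all vertices of $T$ except the leaf adjacent to the central vertex is an IO-code of $T$ of minimum cardinality.
   Context: For a graph $G$, a set $S\subseteq V(G)$ is an identifying open code (IO-code) if every vertex has a neighbor in $S$ and $N_G(u)\cap S \ne N_G(v)\cap S$ for all distinct vertices $u,v$, where $N_G(v)$ is the open neighborhood. $\gamma^{\mathrm{IOC}}(G)$ is the minimum cardinality of an IO-code (defined for isolate-free graphs with no two vertices having equal open neighborhoods). For $k\ge 2$, the subdivided star $T_k$ is obtained from the star $K_{1,k}$ with center $v$ by subdividing every edge exactly once (order $2k+1$). The reduced subdivided star $T_k^*$ is obtained from $T_k$ by removing exactly one leaf (order $2k$); in both, $v$ is called the central vertex, and in $T_k^*$ the central vertex has exactly one leaf neighbor. -}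

module Defs where

open import Data.Nat using (ℕ; zero; suc; _+_; _*_; _≤_; _≤ᵇ_; _≡ᵇ_)
open import Data.Bool using (Bool; true; false; _∧_; _∨_)
open import Data.Bool.Properties using (∨-comm; ∧-zeroʳ)
import Data.Fin
open import Data.Fin using (Fin; toℕ)
open import Data.Fin.Subset using (Subset; _∈_; ∣_∣)
open import Data.Vec using (tabulate; lookup)
open import Data.Product using (Σ; _×_; ∃)
open import Relation.Binary.PropositionalEquality using (_≡_; _≢_; refl)

record Graph (n : ℕ) : Set where
  field
    adj    : Fin n → Fin n → Bool
    sym    : ∀ u v → adj u v ≡ adj v u
    irrefl : ∀ v → adj v v ≡ false
open Graph public

N∩ : ∀ {n} → Graph n → Fin n → Subset n → Subset n
N∩ G v S = tabulate (λ u → adj G v u ∧ lookup S u)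

IsIOCode : ∀ {n} → Graph n → Subset n → Set
IsIOCode {n} G S =
  (∀ (v : Fin n) → ∃ λ (u : Fin n) → (adj G v u ≡ true) × (u ∈ S))
  × (∀ (u v : Fin n) → u ≢ v → N∩ G u S ≢ N∩ G v S)

IsMinIOCode : ∀ {n} → Graph n → Subset n → Set
IsMinIOCode G S = IsIOCode G S × (∀ S′ → IsIOCode G S′ → ∣ S ∣ ≤ ∣ S′ ∣)

IOCNumber : ∀ {n} → Graph n → ℕ → Set
IOCNumber G m =
  (∃ λ S → IsIOCode G S × ∣ S ∣ ≡ m) × (∀ S′ → IsIOCode G S′ → m ≤ ∣ S′ ∣)

IsLeaf : ∀ {n} → Graph n → Fin n → Set
IsLeaf G v = ∃ λ u → (adj G v u ≡ true) × (∀ w → adj G v w ≡ true → w ≡ u)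

-- Labelling of the subdivided star T_k on {0,…,2k}:
--   0 = central vertex, i (1 ≤ i ≤ k) = subdivision vertices,
--   k+i (1 ≤ i ≤ k) = leaf attached to subdivision vertex i.
-- edges: {0,i} and {i,k+i} for 1 ≤ i ≤ k.
arc : ℕ → ℕ → ℕ → Bool
arc k x y = ((x ≡ᵇ 0) ∧ (1 ≤ᵇ y) ∧ (y ≤ᵇ k))
          ∨ ((1 ≤ᵇ x) ∧ (x ≤ᵇ k) ∧ (y ≡ᵇ (x + k)))

tkAdj : ℕ → ℕ → ℕ → Bool
tkAdj k x y = arc k x y ∨ arc k y x

tkAdj-sym : ∀ k x y → tkAdj k x y ≡ tkAdj k y x
tkAdj-sym k x y = ∨-comm (arc k x y) (arc k y x)

private
  ≡ᵇ-+suc : ∀ n m → (n ≡ᵇ (n + suc m)) ≡ false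
  ≡ᵇ-+suc zero    m = refl
  ≡ᵇ-+suc (suc n) m = ≡ᵇ-+suc n m

  arc-irrefl : ∀ k x → arc k x x ≡ false
  arc-irrefl k       zero    = refl
  arc-irrefl zero    (suc x) = refl
  arc-irrefl (suc k) (suc x) rewrite ≡ᵇ-+suc (suc x) k = ∧-zeroʳ (suc x ≤ᵇ suc k)

tkAdj-irrefl : ∀ k x → tkAdj k x x ≡ false
tkAdj-irrefl k x rewrite arc-irrefl k x = refl

T : (k : ℕ) → Graph (2 * k + 1)
T k = record
  { adj    = λ u v → tkAdj k (toℕ u) (toℕ v)
  ; sym    = λ u v → tkAdj-sym k (toℕ u) (toℕ v)
  ; irrefl = λ v → tkAdj-irrefl k (toℕ v)
  }

-- The reduced subdivided star T_k^* (order 2k): T_k with the leaf 2k removed,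
-- i.e. the induced subgraph on {0,…,2k-1}.  Vertex k is then the unique leaf
-- adjacent to the central vertex 0.
T* : (k : ℕ) → Graph (2 * k)
T* k = record
  { adj    = λ u v → tkAdj k (toℕ u) (toℕ v)
  ; sym    = λ u v → tkAdj-sym k (toℕ u) (toℕ v)
  ; irrefl = λ v → tkAdj-irrefl k (toℕ v)
  }

IsCentral : ∀ {n} → Fin n → Set
IsCentral v = toℕ v ≡ 0

-- Every leaf forces its unique neighbour into an IO-code, so every subdivision
-- vertex carrying a leaf lies in the code.  A subdivision vertex without a leaf in
-- the code (in T_k^* this includes the centre's leaf) sees only the centre; two such
-- vertices would have the same trace, and one of them forces the centre into the
-- code since it must be dominated.  Hence an IO-code misses at most one vertex.
-- Conversely the complement of a suitable leaf separates the centre (it sees the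
-- subdivision vertices 1 and 2), the subdivision vertices (by their leaves, all but
-- at most one of which are in the code) and the leaves (each sees only its parent).
module Submission where

open import Defs hiding (sym)
open import Data.Nat using (ℕ; _∸_; _*_; _+_; _≤_)
open import Data.Bool using (true)
open import Data.Fin using (Fin)
open import Data.Fin.Subset using (∁; ⁅_⁆)
open import Data.Product using (_×_; ∃)
open import Relation.Binary.PropositionalEquality using (_≡_)

open import Data.Nat using (zero; suc; _<_; _≡ᵇ_; s≤s; z≤n; _≤?_; _≟_)
open import Data.Nat.Properties
  using ( ≤-refl; ≤-reflexive; ≤-trans; <-≤-trans; ≤-<-trans; ≤-pred; <⇒≤; <⇒≢; ≰⇒>; ≤∧≢⇒<
        ; n<1+n; n≤1+n; +-mono-≤; m+n≮n; m≤m+n; m<m+n; m∸n≤m; m+n∸n≡m; m∸n+n≡m; m<n⇒0<n∸m; +-comm; +-identityʳ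
        ; +-cancelʳ-≡; +-cancelʳ-≤; +-monoˡ-≤; +-monoˡ-<; ≡ᵇ⇒≡; ≡⇒≡ᵇ; ≤ᵇ⇒≤; ≤⇒≤ᵇ )
open import Data.Bool using (Bool; false; _∧_) renaming (T to IsTrue)
open import Data.Bool.Properties using (∧-zeroʳ; ∧-identityʳ; T-≡; T-∧; T-∨)
open import Data.Empty using (⊥-elim)
open import Data.Sum using (_⊎_; inj₁; inj₂)
open import Data.Product using (_,_; proj₁; proj₂)
open import Data.Fin using (toℕ; fromℕ<)
open import Data.Fin.Properties using (toℕ-injective; toℕ<n; toℕ-fromℕ<; fromℕ<-injective; any?)
  renaming (_≟_ to _≟ᶠ_)
open import Data.Fin.Subset using (Subset; _∈_; _∉_; ∣_∣; ⊤; _⊆_)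
open import Data.Fin.Subset.Properties
  using (_∈?_; x∉p⇒x∈∁p; x∈∁p⇒x∉p; x≢y⇒x∉⁅y⁆; x∉⁅y⁆⇒x≢y; ∣∁p∣≡n∸∣p∣; ∣⁅x⁆∣≡1; p⊆q⇒∣p∣≤∣q∣; ∣⊤∣≡n)
open import Data.Vec using (lookup)
open import Data.Vec.Properties using (lookup∘tabulate; []=⇒lookup; lookup⇒[]=; tabulate-cong)
open import Function using (_∘_; Equivalence)
open import Relation.Binary.PropositionalEquality using (_≢_; refl; sym; trans; cong; cong₂; subst; module ≡-Reasoning)
open import Relation.Nullary using (¬_; yes; no; ¬?)
open import Relation.Nullary.Decidable using (decidable-stable)

open Equivalence using (to; from)

bool-ext : ∀ {a b : Bool} → (a ≡ true → b ≡ true) → (b ≡ true → a ≡ true) → a ≡ b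
bool-ext {true}          a⇒b _   = sym (a⇒b refl)
bool-ext {false} {true}  _   b⇒a = b⇒a refl
bool-ext {false} {false} _   _   = refl

module _ {n} (G : Graph n) (S : Subset n) where

  N∩-≡⇒adj : ∀ {u v w} → N∩ G u S ≡ N∩ G v S → w ∈ S → adj G u w ≡ true → adj G v w ≡ true
  N∩-≡⇒adj {u} {v} {w} trace≡ w∈S u~w = begin
    adj G v w                 ≡⟨ sym (∧-identityʳ _) ⟩
    adj G v w ∧ true          ≡⟨ cong (adj G v w ∧_) (sym ([]=⇒lookup w∈S)) ⟩
    adj G v w ∧ lookup S w    ≡⟨ sym (lookup∘tabulate _ w) ⟩
    lookup (N∩ G v S) w       ≡⟨ cong (λ t → lookup t w) (sym trace≡) ⟩
    lookup (N∩ G u S) w       ≡⟨ lookup∘tabulate _ w ⟩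
    adj G u w ∧ lookup S w    ≡⟨ cong₂ _∧_ u~w ([]=⇒lookup w∈S) ⟩
    true                      ∎
    where open ≡-Reasoning

  N∩-≡ : ∀ {u v} →
         (∀ {w} → w ∈ S → adj G u w ≡ true → adj G v w ≡ true) →
         (∀ {w} → w ∈ S → adj G v w ≡ true → adj G u w ≡ true) →
         N∩ G u S ≡ N∩ G v S
  N∩-≡ {u} {v} u⇒v v⇒u = tabulate-cong pointwise
    where
    pointwise : ∀ w → adj G u w ∧ lookup S w ≡ adj G v w ∧ lookup S w
    pointwise w with lookup S w in w∈?S
    ... | false = trans (∧-zeroʳ _) (sym (∧-zeroʳ _))
    ... | true  = cong (_∧ true) (bool-ext (u⇒v w∈S) (v⇒u w∈S))
      where w∈S = lookup⇒[]= w S w∈?S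

two-neighbours⇒¬IsLeaf : ∀ {n} (G : Graph n) {v a b} →
                         adj G v a ≡ true → adj G v b ≡ true → a ≢ b → ¬ IsLeaf G v
two-neighbours⇒¬IsLeaf G v~a v~b a≢b (_ , _ , unique) = a≢b (trans (unique _ v~a) (sym (unique _ v~b)))

∣∁⁅x⁆∣≡n∸1 : ∀ {n} (x : Fin n) → ∣ ∁ ⁅ x ⁆ ∣ ≡ n ∸ 1
∣∁⁅x⁆∣≡n∸1 {n} x = trans (∣∁p∣≡n∸∣p∣ ⁅ x ⁆) (cong (n ∸_) (∣⁅x⁆∣≡1 x))

n∸1≤∣p∣ : ∀ {n} (p : Subset n) → (∀ {x y} → x ∉ p → y ∉ p → x ≡ y) → n ∸ 1 ≤ ∣ p ∣
n∸1≤∣p∣ {n} p outside-unique with any? (λ x → ¬? (x ∈? p))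
... | yes (x , x∉p) = subst (_≤ ∣ p ∣) (∣∁⁅x⁆∣≡n∸1 x) (p⊆q⇒∣p∣≤∣q∣ ∁⁅x⁆⊆p)
  where
  ∁⁅x⁆⊆p : ∁ ⁅ x ⁆ ⊆ p
  ∁⁅x⁆⊆p {y} y∈ = decidable-stable (y ∈? p) (λ y∉p → x∉⁅y⁆⇒x≢y (x∈∁p⇒x∉p y∈) (outside-unique y∉p x∉p))
... | no ∄x∉p = ≤-trans (m∸n≤m n 1) (subst (_≤ ∣ p ∣) (∣⊤∣≡n n) (p⊆q⇒∣p∣≤∣q∣ ⊤⊆p))
  where
  ⊤⊆p : ⊤ ⊆ p
  ⊤⊆p {y} _ = decidable-stable (y ∈? p) (λ y∉p → ∄x∉p (y , y∉p))

CodesMissAtMostOne : ∀ {n} → Graph n → Set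
CodesMissAtMostOne G = ∀ S → IsIOCode G S → ∀ {x y} → x ∉ S → y ∉ S → x ≡ y

module _ {n} (G : Graph n) (x : Fin n) (code : IsIOCode G (∁ ⁅ x ⁆)) (miss≤1 : CodesMissAtMostOne G) where

  ∁⁅x⁆-isMinIOCode : IsMinIOCode G (∁ ⁅ x ⁆)
  ∁⁅x⁆-isMinIOCode = code , λ S S-code →
    subst (_≤ ∣ S ∣) (sym (∣∁⁅x⁆∣≡n∸1 x)) (n∸1≤∣p∣ S (miss≤1 S S-code))

  IOCNumber-n∸1 : IOCNumber G (n ∸ 1)
  IOCNumber-n∸1 = (∁ ⁅ x ⁆ , code , ∣∁⁅x⁆∣≡n∸1 x) , λ S S-code → n∸1≤∣p∣ S (miss≤1 S S-code)

Mid : ℕ → ℕ → Set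
Mid k x = 1 ≤ x × x ≤ k

data Adj (k x y : ℕ) : Set where
  center-mid : x ≡ 0 → Mid k y → Adj k x y
  mid-center : Mid k x → y ≡ 0 → Adj k x y
  mid-leaf   : Mid k x → y ≡ x + k → Adj k x y
  leaf-mid   : x ≡ y + k → Mid k y → Adj k x y

Adj-sym : ∀ {k x y} → Adj k x y → Adj k y x
Adj-sym (center-mid x≡0 my) = mid-center my x≡0
Adj-sym (mid-center mx y≡0) = center-mid y≡0 mx
Adj-sym (mid-leaf mx y≡x+k) = leaf-mid y≡x+k mx
Adj-sym (leaf-mid x≡y+k my) = mid-leaf my x≡y+k

T-∧³ : ∀ {a b c} → IsTrue (a ∧ b ∧ c) → IsTrue a × IsTrue b × IsTrue c
T-∧³ {false} ()
T-∧³ {true} {false} ()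
T-∧³ {true} {true} t = _ , _ , t

arc⇒Adj : ∀ k x y → IsTrue (arc k x y) → Adj k x y
arc⇒Adj k x y t with to T-∨ t
... | inj₁ t′ = let x≡0 , 1≤y , y≤k = T-∧³ t′ in
  center-mid (≡ᵇ⇒≡ x 0 x≡0) (≤ᵇ⇒≤ 1 y 1≤y , ≤ᵇ⇒≤ y k y≤k)
... | inj₂ t′ = let 1≤x , x≤k , y≡x+k = T-∧³ t′ in
  mid-leaf (≤ᵇ⇒≤ 1 x 1≤x , ≤ᵇ⇒≤ x k x≤k) (≡ᵇ⇒≡ y (x + k) y≡x+k)

tkAdj⇒Adj : ∀ {k x y} → tkAdj k x y ≡ true → Adj k x y
tkAdj⇒Adj {k} {x} {y} xy with to T-∨ (from T-≡ xy)
... | inj₁ t = arc⇒Adj k x y t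
... | inj₂ t = Adj-sym (arc⇒Adj k y x t)

center-arc : ∀ {k y} → Mid k y → IsTrue (arc k 0 y)
center-arc (1≤y , y≤k) = from T-∨ (inj₁ (from T-∧ (≤⇒≤ᵇ 1≤y , ≤⇒≤ᵇ y≤k)))

pendant-arc : ∀ {k x} → Mid k x → IsTrue (arc k x (x + k))
pendant-arc {k} {x} (1≤x , x≤k) = from (T-∨ {(x ≡ᵇ 0) ∧ _})
  (inj₂ (from T-∧ (≤⇒≤ᵇ 1≤x , from T-∧ (≤⇒≤ᵇ x≤k , ≡⇒≡ᵇ (x + k) (x + k) refl))))

Adj⇒tkAdj : ∀ {k x y} → Adj k x y → tkAdj k x y ≡ true
Adj⇒tkAdj {k} {x} {y} a = to T-≡ (from (T-∨ {arc k x y}) (arc-or-reversed a))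
  where
  arc-or-reversed : Adj k x y → IsTrue (arc k x y) ⊎ IsTrue (arc k y x)
  arc-or-reversed (center-mid refl my) = inj₁ (center-arc my)
  arc-or-reversed (mid-center mx refl) = inj₂ (center-arc mx)
  arc-or-reversed (mid-leaf mx refl)   = inj₁ (pendant-arc mx)
  arc-or-reversed (leaf-mid refl my)   = inj₂ (pendant-arc my)

pendant≢0 : ∀ {j k} → 1 ≤ j → j + k ≢ 0
pendant≢0 (s≤s _) ()

pendant≰k : ∀ {j k} → 1 ≤ j → ¬ (j + k ≤ k)
pendant≰k {suc j} {k} _ = m+n≮n j k

center-adj : ∀ {k y} → Adj k 0 y → Mid k y
center-adj (center-mid _ my)              = my
center-adj (leaf-mid 0≡y+k (1≤y , _)) = ⊥-elim (pendant≢0 1≤y (sym 0≡y+k))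

mid-adj : ∀ {k x y} → Mid k x → Adj k x y → y ≡ 0 ⊎ y ≡ x + k
mid-adj (() , _) (center-mid refl _)
mid-adj _ (mid-center _ y≡0) = inj₁ y≡0
mid-adj _ (mid-leaf _ y≡x+k) = inj₂ y≡x+k
mid-adj (_ , x≤k) (leaf-mid refl (1≤y , _)) = ⊥-elim (pendant≰k 1≤y x≤k)

leaf-adj : ∀ {j k y} → 1 ≤ j → Adj k (j + k) y → y ≡ j
leaf-adj 1≤j (center-mid j+k≡0 _)       = ⊥-elim (pendant≢0 1≤j j+k≡0)
leaf-adj 1≤j (mid-center (_ , j+k≤k) _) = ⊥-elim (pendant≰k 1≤j j+k≤k)
leaf-adj 1≤j (mid-leaf (_ , j+k≤k) _)   = ⊥-elim (pendant≰k 1≤j j+k≤k)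
leaf-adj {j} {k} {y} _ (leaf-mid j+k≡y+k _) = +-cancelʳ-≡ k y j (sym j+k≡y+k)

data Kind (k x : ℕ) : Set where
  center : x ≡ 0 → Kind k x
  mid    : Mid k x → Kind k x
  leaf   : ∀ j → Mid k j → x ≡ j + k → Kind k x

kind : ∀ k x → x ≤ k + k → Kind k x
kind k zero    _ = center refl
kind k (suc x) x≤k+k with suc x ≤? k
... | yes x≤k = mid (s≤s z≤n , x≤k)
... | no  x≰k = leaf (suc x ∸ k) (m<n⇒0<n∸m k<x , x∸k≤k) (sym (m∸n+n≡m (<⇒≤ k<x)))
  where
  k<x = ≰⇒> x≰k
  x∸k≤k : suc x ∸ k ≤ k
  x∸k≤k = +-cancelʳ-≤ k _ _ (subst (_≤ k + k) (sym (m∸n+n≡m (<⇒≤ k<x))) x≤k+k)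

-- The subgraph of T_k induced by the labels below N: T_k for N = 2k+1, T_k^* for N = 2k.
module Star (k N : ℕ) (N≤1+k+k : N ≤ suc (k + k)) where

  G : Graph N
  G = record
    { adj    = λ u v → tkAdj k (toℕ u) (toℕ v)
    ; sym    = λ u v → tkAdj-sym k (toℕ u) (toℕ v)
    ; irrefl = λ v → tkAdj-irrefl k (toℕ v)
    }

  kindOf : (u : Fin N) → Kind k (toℕ u)
  kindOf u = kind k (toℕ u) (≤-pred (≤-trans (toℕ<n u) N≤1+k+k))

  adj⇒Adj : ∀ {u w x y} → toℕ u ≡ x → toℕ w ≡ y → adj G u w ≡ true → Adj k x y
  adj⇒Adj refl refl = tkAdj⇒Adj

  Adj⇒adj : ∀ {u w x y} → toℕ u ≡ x → toℕ w ≡ y → Adj k x y → adj G u w ≡ true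
  Adj⇒adj refl refl = Adj⇒tkAdj

  relabel : ∀ {S : Subset N} {w x m} → toℕ w ≡ m → toℕ x ≡ m → w ∈ S → x ∈ S
  relabel {S} w≡m x≡m = subst (_∈ S) (toℕ-injective (trans w≡m (sym x≡m)))

  parent<N : ∀ {x j} → toℕ x ≡ j + k → j < N
  parent<N {x} {j} x≡j+k = ≤-<-trans (m≤m+n j k) (subst (_< N) x≡j+k (toℕ<n x))

  pendant-parent-not-leaf : ∀ {u} → Mid k (toℕ u) → toℕ u + k < N → ¬ IsLeaf G u
  pendant-parent-not-leaf {u} mu p = two-neighbours⇒¬IsLeaf G {u}
    (Adj⇒adj refl (toℕ-fromℕ< 0<N) (mid-center mu refl))
    (Adj⇒adj refl (toℕ-fromℕ< p) (mid-leaf mu refl))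
    (pendant≢0 (proj₁ mu) ∘ sym ∘ fromℕ<-injective _ _ 0<N p)
    where 0<N = ≤-<-trans z≤n p

  center-not-leaf : 2 ≤ k → k < N → ∀ {u} → toℕ u ≡ 0 → ¬ IsLeaf G u
  center-not-leaf 2≤k k<N {u} u≡0 = two-neighbours⇒¬IsLeaf G {u}
    (Adj⇒adj u≡0 (toℕ-fromℕ< 1<N) (center-mid refl (≤-refl , ≤-trans (s≤s z≤n) 2≤k)))
    (Adj⇒adj u≡0 (toℕ-fromℕ< 2<N) (center-mid refl (s≤s z≤n , 2≤k)))
    (λ 1≡2 → <⇒≢ (n<1+n 1) (fromℕ<-injective _ _ 1<N 2<N 1≡2))
    where
    2<N = ≤-<-trans 2≤k k<N
    1<N = ≤-<-trans (s≤s z≤n) 2<N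

  pendant<N-T : k + k < N → ∀ {x} → Mid k x → x + k < N
  pendant<N-T k+k<N (_ , x≤k) = ≤-<-trans (+-monoˡ-≤ k x≤k) k+k<N

  pendant<N-T* : N ≡ k + k → ∀ {x} → Mid k x → x ≢ k → x + k < N
  pendant<N-T* N≡k+k (_ , x≤k) x≢k = <-≤-trans (+-monoˡ-< k (≤∧≢⇒< x≤k x≢k)) (≤-reflexive (sym N≡k+k))

  leaf-of-T⇒pendant : 2 ≤ k → k + k < N → ∀ {ℓ} → IsLeaf G ℓ → ∃ λ i → Mid k i × toℕ ℓ ≡ i + k
  leaf-of-T⇒pendant 2≤k k+k<N {ℓ} ℓ-leaf with kindOf ℓ
  ... | center ℓ≡0      = ⊥-elim (center-not-leaf 2≤k (≤-<-trans (m≤m+n k k) k+k<N) ℓ≡0 ℓ-leaf)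
  ... | mid mℓ          = ⊥-elim (pendant-parent-not-leaf mℓ (pendant<N-T k+k<N mℓ) ℓ-leaf)
  ... | leaf i mi ℓ≡i+k = i , mi , ℓ≡i+k

  center-leaf-of-T*≡k : N ≡ k + k → ∀ {c ℓ} → toℕ c ≡ 0 → adj G c ℓ ≡ true → IsLeaf G ℓ → toℕ ℓ ≡ k
  center-leaf-of-T*≡k N≡k+k {c} {ℓ} c≡0 c~ℓ ℓ-leaf with toℕ ℓ ≟ k
  ... | yes ℓ≡k = ℓ≡k
  ... | no  ℓ≢k = ⊥-elim (pendant-parent-not-leaf mℓ (pendant<N-T* N≡k+k mℓ ℓ≢k) ℓ-leaf)
    where mℓ = center-adj (adj⇒Adj {c} {ℓ} c≡0 refl c~ℓ)

  -- d is the subdivision vertex whose leaf may be absent from the code.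
  module LeafComplement (2≤k : 2 ≤ k) (k<N : k < N) (ℓ : Fin N) (3≤ℓ : 3 ≤ toℕ ℓ) (d : ℕ)
           (parent≢ℓ : ∀ {j} → j + k < N → j ≢ toℕ ℓ)
           (pendant∈ : ∀ {j} → Mid k j → j ≢ d → j + k < N × j + k ≢ toℕ ℓ) where

    S : Subset N
    S = ∁ ⁅ ℓ ⁆

    Twins : Fin N → Fin N → Set
    Twins u v = N∩ G u S ≡ N∩ G v S

    label∈S : ∀ {m} (p : m < N) → m ≢ toℕ ℓ → fromℕ< p ∈ S
    label∈S p m≢ℓ = x∉p⇒x∈∁p (x≢y⇒x∉⁅y⁆ (m≢ℓ ∘ trans (sym (toℕ-fromℕ< p)) ∘ cong toℕ))

    small≢ℓ : ∀ {m} → m < 3 → m ≢ toℕ ℓ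
    small≢ℓ m<3 = <⇒≢ (<-≤-trans m<3 3≤ℓ)

    mid1 : Mid k 1
    mid1 = ≤-refl , ≤-trans (s≤s z≤n) 2≤k

    mid2 : Mid k 2
    mid2 = s≤s z≤n , 2≤k

    2<N : 2 < N
    2<N = ≤-<-trans 2≤k k<N

    1<N : 1 < N
    1<N = ≤-<-trans (s≤s z≤n) 2<N

    0<N : 0 < N
    0<N = ≤-<-trans z≤n 1<N

    dominated-by : ∀ {v m} (p : m < N) → m ≢ toℕ ℓ → Adj k (toℕ v) m →
                   ∃ λ w → adj G v w ≡ true × w ∈ S
    dominated-by p m≢ℓ v~m = fromℕ< p , Adj⇒adj refl (toℕ-fromℕ< p) v~m , label∈S p m≢ℓ

    dominating : ∀ v → ∃ λ w → adj G v w ≡ true × w ∈ S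
    dominating v with kindOf v
    ... | center v≡0      = dominated-by 1<N (small≢ℓ (s≤s (s≤s z≤n))) (center-mid v≡0 mid1)
    ... | mid mv          = dominated-by 0<N (small≢ℓ (s≤s z≤n)) (mid-center mv refl)
    ... | leaf j mj v≡j+k = dominated-by (parent<N v≡j+k)
                              (parent≢ℓ (subst (_< N) v≡j+k (toℕ<n v))) (leaf-mid v≡j+k mj)

    shared : ∀ {u v m} → Twins u v → (p : m < N) → m ≢ toℕ ℓ → Adj k (toℕ u) m → Adj k (toℕ v) m
    shared {u} {v} twins p m≢ℓ u~m = adj⇒Adj {v} refl (toℕ-fromℕ< p)
      (N∩-≡⇒adj G S {u} {v} twins (label∈S p m≢ℓ) (Adj⇒adj {u} refl (toℕ-fromℕ< p) u~m))

    center-twin-sees : ∀ {u v m} → Twins u v → toℕ u ≡ 0 → m < N → m < 3 → Mid k m →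
                       toℕ v ≡ 0 ⊎ toℕ v ≡ m + k
    center-twin-sees twins u≡0 p m<3 mm =
      mid-adj mm (Adj-sym (shared twins p (small≢ℓ m<3) (center-mid u≡0 mm)))

    center-twin : ∀ {u v} → Twins u v → toℕ u ≡ 0 → toℕ v ≡ 0
    center-twin twins u≡0 with center-twin-sees twins u≡0 1<N (s≤s (s≤s z≤n)) mid1
                             | center-twin-sees twins u≡0 2<N ≤-refl mid2
    ... | inj₁ v≡0   | _          = v≡0
    ... | inj₂ _     | inj₁ v≡0   = v≡0
    ... | inj₂ v≡1+k | inj₂ v≡2+k = ⊥-elim (<⇒≢ (n<1+n (1 + k)) (trans (sym v≡1+k) v≡2+k))

    mid-twin-is-mid : ∀ {u v} → Twins u v → Mid k (toℕ u) → Mid k (toℕ v)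
    mid-twin-is-mid twins mu = center-adj (Adj-sym (shared twins 0<N (small≢ℓ (s≤s z≤n)) (mid-center mu refl)))

    mid-twin-by-pendant : ∀ {u v} → Twins u v → Mid k (toℕ u) → toℕ u + k < N → toℕ u + k ≢ toℕ ℓ →
                          toℕ u ≡ toℕ v
    mid-twin-by-pendant twins mu p u+k≢ℓ
      with mid-adj (mid-twin-is-mid twins mu) (shared twins p u+k≢ℓ (mid-leaf mu refl))
    ... | inj₁ u+k≡0   = ⊥-elim (pendant≢0 (proj₁ mu) u+k≡0)
    ... | inj₂ u+k≡v+k = +-cancelʳ-≡ k _ _ u+k≡v+k

    mid-twin : ∀ {u v} → Twins u v → Mid k (toℕ u) → toℕ u ≡ toℕ v
    mid-twin {u} {v} twins mu with toℕ u ≟ d | toℕ v ≟ d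
    ... | no u≢d  | _       = let p , u+k≢ℓ = pendant∈ mu u≢d in mid-twin-by-pendant twins mu p u+k≢ℓ
    ... | yes _   | no v≢d  = let p , v+k≢ℓ = pendant∈ (mid-twin-is-mid twins mu) v≢d in
                              sym (mid-twin-by-pendant (sym twins) (mid-twin-is-mid twins mu) p v+k≢ℓ)
    ... | yes u≡d | yes v≡d = trans u≡d (sym v≡d)

    leaf-twin : ∀ {u v j} → Twins u v → Mid k j → toℕ u ≡ j + k → toℕ u ≡ toℕ v
    leaf-twin {u} twins mj u≡j+k with mid-adj mj (Adj-sym (shared twins (parent<N u≡j+k)
                                        (parent≢ℓ (subst (_< N) u≡j+k (toℕ<n u))) (leaf-mid u≡j+k mj)))
    ... | inj₁ v≡0   = ⊥-elim (pendant≢0 (proj₁ mj) (trans (sym u≡j+k) (center-twin (sym twins) v≡0)))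
    ... | inj₂ v≡j+k = trans u≡j+k (sym v≡j+k)

    twins-equal : ∀ {u v} → Twins u v → toℕ u ≡ toℕ v
    twins-equal {u} twins with kindOf u
    ... | center u≡0      = trans u≡0 (sym (center-twin twins u≡0))
    ... | mid mu          = mid-twin twins mu
    ... | leaf j mj u≡j+k = leaf-twin twins mj u≡j+k

    isIOCode : IsIOCode G S
    isIOCode = dominating , λ u v u≢v twins → u≢v (toℕ-injective (twins-equal twins))

  module AnyIOCode (S : Subset N) (code : IsIOCode G S) where

    parent∈S : ∀ {x} → 1 ≤ toℕ x → toℕ x + k < N → x ∈ S
    parent∈S {x} 1≤x p with proj₁ code (fromℕ< p)
    ... | w , leaf~w , w∈S = relabel (leaf-adj 1≤x (adj⇒Adj (toℕ-fromℕ< p) refl leaf~w)) refl w∈S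

    Lonely : ℕ → Set
    Lonely i = ∀ {a w} → toℕ a ≡ i → w ∈ S → adj G a w ≡ true → toℕ w ≡ 0

    missing-pendant⇒lonely : ∀ {x j} → Mid k j → toℕ x ≡ j + k → x ∉ S → Lonely j
    missing-pendant⇒lonely mj x≡j+k x∉S a≡j w∈S a~w with mid-adj mj (adj⇒Adj a≡j refl a~w)
    ... | inj₁ w≡0   = w≡0
    ... | inj₂ w≡j+k = ⊥-elim (x∉S (relabel w≡j+k x≡j+k w∈S))

    lonely⇒center∈S : ∀ {j x} → j < N → Lonely j → toℕ x ≡ 0 → x ∈ S
    lonely⇒center∈S p lonely x≡0 with proj₁ code (fromℕ< p)
    ... | w , j~w , w∈S = relabel (lonely (toℕ-fromℕ< p) w∈S j~w) x≡0 w∈S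

    lonely-mids-equal : ∀ {i j} → i < N → j < N → Mid k i → Mid k j → Lonely i → Lonely j → i ≡ j
    lonely-mids-equal p q mi mj i-lonely j-lonely =
      fromℕ<-injective _ _ p q (decidable-stable (a ≟ᶠ b) (λ a≢b → proj₂ code a b a≢b same-trace))
      where
      a = fromℕ< p
      b = fromℕ< q
      same-trace : N∩ G a S ≡ N∩ G b S
      same-trace = N∩-≡ G S {a} {b}
        (λ w∈S a~w → Adj⇒adj (toℕ-fromℕ< q) refl (mid-center mj (i-lonely {a} (toℕ-fromℕ< p) w∈S a~w)))
        (λ w∈S b~w → Adj⇒adj (toℕ-fromℕ< p) refl (mid-center mi (j-lonely {b} (toℕ-fromℕ< q) w∈S b~w)))

    missing-pendant⇒center∈S : ∀ {x y j} → Mid k j → toℕ y ≡ j + k → y ∉ S → toℕ x ≡ 0 → x ∈ S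
    missing-pendant⇒center∈S mj y≡j+k y∉S =
      lonely⇒center∈S (parent<N y≡j+k) (missing-pendant⇒lonely mj y≡j+k y∉S)

    module _ (k+k<N : k + k < N) where

      outside-T : ∀ {x} → x ∉ S → toℕ x ≡ 0 ⊎ ∃ λ j → Mid k j × toℕ x ≡ j + k
      outside-T {x} x∉S with kindOf x
      ... | center x≡0      = inj₁ x≡0
      ... | mid mx          = ⊥-elim (x∉S (parent∈S (proj₁ mx) (pendant<N-T k+k<N mx)))
      ... | leaf j mj x≡j+k = inj₂ (j , mj , x≡j+k)

      missAtMostOne-T : ∀ {x y} → x ∉ S → y ∉ S → x ≡ y
      missAtMostOne-T {x} {y} x∉S y∉S with outside-T x∉S | outside-T y∉S
      ... | inj₁ x≡0 | inj₁ y≡0 = toℕ-injective (trans x≡0 (sym y≡0))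
      ... | inj₁ x≡0 | inj₂ (j , mj , y≡j+k) = ⊥-elim (x∉S (missing-pendant⇒center∈S mj y≡j+k y∉S x≡0))
      ... | inj₂ (i , mi , x≡i+k) | inj₁ y≡0 = ⊥-elim (y∉S (missing-pendant⇒center∈S mi x≡i+k x∉S y≡0))
      ... | inj₂ (i , mi , x≡i+k) | inj₂ (j , mj , y≡j+k) =
        toℕ-injective (trans x≡i+k (trans (cong (_+ k) i≡j) (sym y≡j+k)))
        where
        i≡j = lonely-mids-equal (parent<N x≡i+k) (parent<N y≡j+k) mi mj
                (missing-pendant⇒lonely mi x≡i+k x∉S) (missing-pendant⇒lonely mj y≡j+k y∉S)

    module _ (1≤k : 1 ≤ k) (N≡k+k : N ≡ k + k) where

      k<N : k < N
      k<N = <-≤-trans (m<m+n k 1≤k) (≤-reflexive (sym N≡k+k))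

      k-lonely : Lonely k
      k-lonely a≡k w∈S a~w with mid-adj (1≤k , ≤-refl) (adj⇒Adj a≡k refl a~w)
      ... | inj₁ w≡0   = w≡0
      ... | inj₂ w≡k+k = ⊥-elim (<⇒≢ (toℕ<n _) (trans w≡k+k (sym N≡k+k)))

      outside-T* : ∀ {x} → x ∉ S → toℕ x ≡ k
      outside-T* {x} x∉S with kindOf x | toℕ x ≟ k
      ... | _ | yes x≡k = x≡k
      ... | center x≡0 | no _ = ⊥-elim (x∉S (lonely⇒center∈S k<N k-lonely x≡0))
      ... | mid mx | no x≢k = ⊥-elim (x∉S (parent∈S (proj₁ mx) (pendant<N-T* N≡k+k mx x≢k)))
      ... | leaf j mj x≡j+k | no _ = ⊥-elim (<⇒≢ (toℕ<n x) (trans x≡j+k (trans (cong (_+ k) j≡k) (sym N≡k+k))))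
        where
        j≡k = lonely-mids-equal (parent<N x≡j+k) k<N mj (1≤k , ≤-refl) (missing-pendant⇒lonely mj x≡j+k x∉S) k-lonely

      missAtMostOne-T* : ∀ {x y} → x ∉ S → y ∉ S → x ≡ y
      missAtMostOne-T* x∉S y∉S = toℕ-injective (trans (outside-T* x∉S) (sym (outside-T* y∉S)))

  pendant-complement-isIOCode : 2 ≤ k → k + k < N → ∀ {ℓ i} → Mid k i → toℕ ℓ ≡ i + k →
                                IsIOCode G (∁ ⁅ ℓ ⁆)
  pendant-complement-isIOCode 2≤k k+k<N {ℓ} {i} (1≤i , _) ℓ≡i+k =
    LeafComplement.isIOCode 2≤k (≤-<-trans (m≤m+n k k) k+k<N) ℓ 3≤ℓ i parent≢ℓ pendant∈
    where
    3≤ℓ : 3 ≤ toℕ ℓ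
    3≤ℓ = subst (3 ≤_) (sym ℓ≡i+k) (+-mono-≤ 1≤i 2≤k)
    parent≢ℓ : ∀ {j} → j + k < N → j ≢ toℕ ℓ
    parent≢ℓ {j} j+k<N j≡ℓ = pendant≰k 1≤i (subst (_≤ k) (trans j≡ℓ ℓ≡i+k) j≤k)
      where j≤k = +-cancelʳ-≤ k j k (≤-pred (≤-trans j+k<N N≤1+k+k))
    pendant∈ : ∀ {j} → Mid k j → j ≢ i → j + k < N × j + k ≢ toℕ ℓ
    pendant∈ {j} mj j≢i = pendant<N-T k+k<N mj , λ j+k≡ℓ → j≢i (+-cancelʳ-≡ k j i (trans j+k≡ℓ ℓ≡i+k))

  k-complement-isIOCode : 3 ≤ k → N ≡ k + k → ∀ {ℓ} → toℕ ℓ ≡ k → IsIOCode G (∁ ⁅ ℓ ⁆)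
  k-complement-isIOCode 3≤k N≡k+k {ℓ} ℓ≡k =
    LeafComplement.isIOCode 2≤k k<N ℓ (subst (3 ≤_) (sym ℓ≡k) 3≤k) k parent≢ℓ pendant∈
    where
    2≤k = ≤-trans (n≤1+n 2) 3≤k
    k<N = <-≤-trans (m<m+n k (≤-trans (s≤s z≤n) 2≤k)) (≤-reflexive (sym N≡k+k))
    parent≢ℓ : ∀ {j} → j + k < N → j ≢ toℕ ℓ
    parent≢ℓ j+k<N j≡ℓ = <⇒≢ (subst (λ j → j + k < N) (trans j≡ℓ ℓ≡k) j+k<N) (sym N≡k+k)
    pendant∈ : ∀ {j} → Mid k j → j ≢ k → j + k < N × j + k ≢ toℕ ℓ
    pendant∈ mj@(1≤j , _) j≢k =
      pendant<N-T* N≡k+k mj j≢k , λ j+k≡ℓ → pendant≰k 1≤j (≤-reflexive (trans j+k≡ℓ ℓ≡k))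

2k+1≡1+k+k : ∀ k → 2 * k + 1 ≡ suc (k + k)
2k+1≡1+k+k k = trans (+-comm (2 * k) 1) (cong (λ t → suc (k + t)) (+-identityʳ k))

2k≡k+k : ∀ k → 2 * k ≡ k + k
2k≡k+k k = cong (k +_) (+-identityʳ k)

subdivided-star : (k : ℕ) → 2 ≤ k →
  (∃ λ m → IOCNumber (T k) m × m * (2 * k + 1) ≡ (2 * k) * (2 * k + 1))
  × (∀ (ℓ : Fin (2 * k + 1)) → IsLeaf (T k) ℓ → IsMinIOCode (T k) (∁ ⁅ ℓ ⁆))
subdivided-star k 2≤k =
  (2 * k + 1 ∸ 1 , IOCNumber-n∸1 G ℓ₀ (pendant-complement-isIOCode 2≤k k+k<N (≤-trans (s≤s z≤n) 2≤k , ≤-refl) (toℕ-fromℕ< k+k<N)) miss≤1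
                 , cong (_* (2 * k + 1)) (m+n∸n≡m (2 * k) 1)) ,
  λ ℓ ℓ-leaf → let i , mi , ℓ≡i+k = leaf-of-T⇒pendant 2≤k k+k<N ℓ-leaf in
    ∁⁅x⁆-isMinIOCode G ℓ (pendant-complement-isIOCode 2≤k k+k<N mi ℓ≡i+k) miss≤1
  where
  open Star k (2 * k + 1) (≤-reflexive (2k+1≡1+k+k k))
  k+k<N : k + k < 2 * k + 1
  k+k<N = ≤-reflexive (sym (2k+1≡1+k+k k))
  ℓ₀ = fromℕ< k+k<N
  miss≤1 : CodesMissAtMostOne G
  miss≤1 S code = AnyIOCode.missAtMostOne-T S code k+k<N

reduced-subdivided-star : (k : ℕ) → 3 ≤ k →
  (∃ λ m → IOCNumber (T* k) m × m * (2 * k) ≡ (2 * k ∸ 1) * (2 * k))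
  × (∀ (c ℓ : Fin (2 * k)) → IsCentral c → IsLeaf (T* k) ℓ → adj (T* k) c ℓ ≡ true →
       IsMinIOCode (T* k) (∁ ⁅ ℓ ⁆))
reduced-subdivided-star k 3≤k =
  (2 * k ∸ 1 , IOCNumber-n∸1 G ℓ₀ (k-complement-isIOCode 3≤k N≡k+k (toℕ-fromℕ< k<N)) miss≤1 , refl) ,
  λ c ℓ c-central ℓ-leaf c~ℓ →
    ∁⁅x⁆-isMinIOCode G ℓ (k-complement-isIOCode 3≤k N≡k+k (center-leaf-of-T*≡k N≡k+k c-central c~ℓ ℓ-leaf)) miss≤1
  where
  N≡k+k = 2k≡k+k k
  open Star k (2 * k) (≤-trans (≤-reflexive N≡k+k) (n≤1+n _))
  1≤k = ≤-trans (s≤s z≤n) 3≤k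
  k<N = <-≤-trans (m<m+n k 1≤k) (≤-reflexive (sym N≡k+k))
  ℓ₀ = fromℕ< k<N
  miss≤1 : CodesMissAtMostOne G
  miss≤1 S code = AnyIOCode.missAtMostOne-T* S code 1≤k N≡k+k

proposition1 : (k : ℕ) → 2 ≤ k →
    ( (∃ λ m → IOCNumber (T k) m × m * (2 * k + 1) ≡ (2 * k) * (2 * k + 1))
    × (∀ (ℓ : Fin (2 * k + 1)) → IsLeaf (T k) ℓ → IsMinIOCode (T k) (∁ ⁅ ℓ ⁆)) )
    × ( 3 ≤ k →
    (∃ λ m → IOCNumber (T* k) m × m * (2 * k) ≡ (2 * k ∸ 1) * (2 * k))
    × (∀ (c ℓ : Fin (2 * k)) → IsCentral c → IsLeaf (T* k) ℓ → adj (T* k) c ℓ ≡ true →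
    IsMinIOCode (T* k) (∁ ⁅ ℓ ⁆)) )
proposition1 k 2≤k = subdivided-star k 2≤k , reduced-subdivided-star k
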